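{- Let $n\ge4$. For every integer $0\le m\le\lfloor n^2/4\rfloor$, $\Theta_{n+1}(m)=\Theta_n(m)+1$.
   Context: All graphs are finite, simple and undirected. A clique cover of $G=(V,E)$ is a family of vertex sets, each inducing a clique, whose union is $V$ and such that every edge lies in some member. $\theta(G)$ is the minimum size of a clique cover of $G$. For $0\le m\le\binom n2$, $\Theta_n(m)$ is the maximum of $\theta(G)$ over all graphs $G$ with $n$ vertices and $m$ edges. -}

module Defs where

open import Data.Nat using (ℕ; _≤_)
open import Data.Bool using (Bool; true; false; _∧_)
open import Data.Fin using (Fin; toℕ)
open import Data.Fin.Subset using (Subset; _∈_)
open import Data.List using (List; length; filter; cartesianProduct; allFin)
open import Data.List.Relation.Unary.All using (All)
open import Data.List.Relation.Unary.Any using (Any)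
open import Data.Product using (Σ; _×_; proj₁; proj₂; ∃)
open import Relation.Binary.PropositionalEquality using (_≡_; _≢_)
open import Relation.Nullary.Decidable using (does)
open import Data.Nat using (_<ᵇ_)
open import Data.Bool using (T?)

record Graph (n : ℕ) : Set where
  field
    adj    : Fin n → Fin n → Bool
    sym    : ∀ i j → adj i j ≡ adj j i
    irrefl : ∀ i → adj i i ≡ false
open Graph public

edgeCount : ∀ {n} → Graph n → ℕ
edgeCount {n} G =
  length (filter (λ p → T? ((toℕ (proj₁ p) <ᵇ toℕ (proj₂ p)) ∧ adj G (proj₁ p) (proj₂ p)))
                 (cartesianProduct (allFin n) (allFin n)))

IsClique : ∀ {n} → Graph n → Subset n → Set
IsClique G S = ∀ i j → i ∈ S → j ∈ S → i ≢ j → adj G i j ≡ true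

IsCliqueCover : ∀ {n} → Graph n → List (Subset n) → Set
IsCliqueCover {n} G C =
  All (IsClique G) C
  × (∀ (v : Fin n) → Any (v ∈_) C)
  × (∀ (i j : Fin n) → adj G i j ≡ true → Any (λ S → i ∈ S × j ∈ S) C)

IsTheta : ∀ {n} → Graph n → ℕ → Set
IsTheta G k =
  (Σ (List _) λ C → IsCliqueCover G C × length C ≡ k)
  × (∀ C → IsCliqueCover G C → k ≤ length C)

IsBigTheta : ℕ → ℕ → ℕ → Set
IsBigTheta n m t =
  (Σ (Graph n) λ G → edgeCount G ≡ m × IsTheta G t)
  × (∀ (G : Graph n) → edgeCount G ≡ m → ∀ k → IsTheta G k → k ≤ t)

-- Adding an isolated vertex gives Θ_{n+1}(m) ≥ Θ_n(m) + 1. Conversely, let G have n + 1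
-- vertices and m edges. If G has an isolated vertex v then θ(G) = θ(G − v) + 1 ≤ Θ_n(m) + 1;
-- otherwise the m edges of G form a clique cover, so θ(G) ≤ m. Hence the claim follows once
-- m ≤ Θ_n(m). For m ≤ ⌊n²/4⌋ some bipartite graph on ⌊n/2⌋ + ⌈n/2⌉ vertices has exactly m
-- edges; it is triangle-free, so each clique contains at most one edge, and its θ is at least m.
-- Since θ and Θ are specified only by extremal properties, both are found by exhaustive search.
module Submission where

open import Data.Bool using (Bool; true; false; _∧_; _∨_; T; T?)
import Data.Bool.Properties as Bool
open import Data.Empty using (⊥; ⊥-elim)
open import Data.Fin using (Fin; zero; suc; toℕ; _↑ˡ_; _↑ʳ_; combine; splitAt; punchIn; punchOut)
open import Data.Fin.Properties
  using (_≟_; all?; any?; ¬∀⟶∃¬; <⇒≢; toℕ-injective; toℕ<n; toℕ-↑ˡ; toℕ-↑ʳ; splitAt-↑ˡ; splitAt-↑ʳ;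
         punchIn-injective; punchInᵢ≢i; punchIn-punchOut; injective⇒≤)
open import Data.Fin.Subset using (Subset; outside; _∈_; _∉_; ⁅_⁆; _∪_)
open import Data.Fin.Subset.Properties using (_∈?_; anySubset?; x∈⁅x⁆; x∈⁅y⁆⇒x≡y; x∈p∪q⁺; x∈p∪q⁻)
open import Data.List as List using (List; []; _∷_; _++_; length; filter; map; tabulate; allFin; cartesianProduct)
open import Data.List.Membership.Propositional using () renaming (_∈_ to _∈ₗ_)
open import Data.List.Membership.Propositional.Properties
  using (∈-lookup; ∈-filter⁺; ∈-filter⁻; ∈-cartesianProduct⁺; ∈-allFin)
open import Data.List.Properties using (length-++; length-map; length-tabulate; map-tabulate; filter-++; filter-notAll)
open import Data.List.Relation.Unary.All as All using (All; []; _∷_)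
import Data.List.Relation.Unary.All.Properties as All
open import Data.List.Relation.Unary.AllPairs using (_∷_)
open import Data.List.Relation.Unary.Any as Any using (Any; here; there)
import Data.List.Relation.Unary.Any.Properties as Any
open import Data.List.Relation.Unary.Unique.Propositional using (Unique)
import Data.List.Relation.Unary.Unique.Propositional.Properties as Unique
open import Data.Nat using (ℕ; zero; suc; _+_; _*_; _/_; _≤_; _<_; _≥_; _<ᵇ_; z≤n; s≤s; z<s)
open import Data.Nat.DivMod using (m<n*o⇒m/o<n)
open import Data.Nat.Induction using (<-rec)
open import Data.Nat.Properties
  using (+-0-commutativeMonoid; +-assoc; +-suc; +-identityʳ; ≤-refl; ≤-trans; ≤-antisym; <⇒≤; ≤-<-trans;
         ≮⇒≥; ≤∧≢⇒<; m≤n⇒m<n∨m≡n; m<1+n⇒m≤n; n≤1+n; m≤m+n; m<m+n; <-cmp; <-irrefl; <-asym;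
         <⇒<ᵇ; <ᵇ⇒<; anyUpTo?; module ≤-Reasoning)
import Data.Nat.Properties as ℕ
open import Data.Nat.Solver using (module +-*-Solver)
open import Data.Product as Product using (_×_; _,_; proj₁; proj₂; ∃; uncurry; swap)
open import Data.Sum using (_⊎_; inj₁; inj₂; [_,_]′)
open import Data.Vec as Vec using (Vec; []; _∷_; lookup; insertAt)
open import Data.Vec.Properties
  using (lookup∘tabulate; insertAt-lookup; insertAt-punchIn; lookup⇒[]=; []=⇒lookup; length-toList; toList∘fromList)
open import Function using (_∘_; id)
open import Function.Bundles using (Equivalence)
open import Relation.Binary using (tri<; tri≈; tri>)
open import Relation.Binary.PropositionalEquality
  using (_≡_; _≢_; refl; sym; trans; cong; cong₂; subst; subst₂; module ≡-Reasoning)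
open import Relation.Nullary using (¬_; Dec; yes; no; ¬?; contradiction)
open import Relation.Nullary.Decidable using (map′; _×-dec_; _→-dec_)
open import Relation.Unary using (Decidable)

open import Algebra.Properties.CommutativeMonoid.Sum +-0-commutativeMonoid
  using (sum; sum-syntax; sum-cong-≗; sum-remove; sum-replicate-zero)
open import Defs hiding (sym)

<⇒<ᵇ≡true : ∀ {m n} → m < n → (m <ᵇ n) ≡ true
<⇒<ᵇ≡true = Equivalence.to Bool.T-≡ ∘ <⇒<ᵇ

≥⇒<ᵇ≡false : ∀ {m n} → m ≥ n → (m <ᵇ n) ≡ false
≥⇒<ᵇ≡false {n = zero}  _         = refl
≥⇒<ᵇ≡false {n = suc n} (s≤s n≤m) = ≥⇒<ᵇ≡false n≤m

indicator : Bool → ℕ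
indicator true  = 1
indicator false = 0

sum-zero : ∀ {n} {f : Fin n → ℕ} → (∀ i → f i ≡ 0) → sum f ≡ 0
sum-zero {n} f≗0 = trans (sum-cong-≗ f≗0) (sum-replicate-zero n)

sum-↑ : ∀ m {n} (f : Fin (m + n) → ℕ) → sum f ≡ sum (f ∘ (_↑ˡ n)) + sum (f ∘ (m ↑ʳ_))
sum-↑ zero    f = refl
sum-↑ (suc m) f = trans (cong (f zero +_) (sum-↑ m (f ∘ suc))) (sym (+-assoc (f zero) _ _))

sum-combine : ∀ m n (f : Fin (m * n) → ℕ) → ∑[ i < m ] ∑[ j < n ] f (combine i j) ≡ sum f
sum-combine zero    n f = refl
sum-combine (suc m) n f = begin
  ∑[ j < n ] f (j ↑ˡ (m * n)) + ∑[ i < m ] ∑[ j < n ] f (n ↑ʳ combine i j)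
    ≡⟨ cong (∑[ j < n ] f (j ↑ˡ (m * n)) +_) (sum-combine m n (f ∘ (n ↑ʳ_))) ⟩
  ∑[ j < n ] f (j ↑ˡ (m * n)) + ∑[ k < m * n ] f (n ↑ʳ k)
    ≡⟨ sum-↑ n f ⟨
  sum f ∎
  where open ≡-Reasoning

sum-indicator-< : ∀ {N} m → m ≤ N → ∑[ k < N ] indicator (toℕ k <ᵇ m) ≡ m
sum-indicator-< {N} zero    _         = sum-zero {N} λ _ → refl
sum-indicator-<     (suc m) (s≤s m≤N) = cong suc (sum-indicator-< m m≤N)

parity : ∀ n → ∃ λ h → n ≡ h + h ⊎ n ≡ suc (h + h)
parity zero = 0 , inj₁ refl
parity (suc n) with parity n
... | h , inj₁ refl = h , inj₂ refl
... | h , inj₂ refl = suc h , inj₁ (cong suc (sym (+-suc h h)))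

balancedSplit : ∀ n → ∃ λ a → ∃ λ b → a + b ≡ n × n * n < suc (a * b) * 4
balancedSplit n with parity n
... | h , inj₁ refl = h , h , refl , subst ((h + h) * (h + h) <_) square (m<m+n _ z<s)
  where
  open +-*-Solver
  square : (h + h) * (h + h) + 4 ≡ suc (h * h) * 4
  square = solve 1 (λ h → (h :+ h) :* (h :+ h) :+ con 4 := (con 1 :+ h :* h) :* con 4) refl h
... | h , inj₂ refl = h , suc h , +-suc h h , subst (suc (h + h) * suc (h + h) <_) square (m<m+n _ z<s)
  where
  open +-*-Solver
  square : suc (h + h) * suc (h + h) + 3 ≡ suc (h * suc h) * 4
  square = solve 1 (λ h → (con 1 :+ (h :+ h)) :* (con 1 :+ (h :+ h)) :+ con 3
                         := (con 1 :+ h :* (con 1 :+ h)) :* con 4) refl h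

≤quarterSquare⇒≤product : ∀ n {m} → m ≤ n * n / 4 → ∃ λ a → ∃ λ b → a + b ≡ n × m ≤ a * b
≤quarterSquare⇒≤product n m≤n²/4 =
  let a , b , a+b≡n , n²<4[1+ab] = balancedSplit n
  in a , b , a+b≡n , m<1+n⇒m≤n (≤-<-trans m≤n²/4 (m<n*o⇒m/o<n n²<4[1+ab]))

-- Searching finite domains

module _ {P : ℕ → Set} (P? : Decidable P) where

  least : ∀ {n} → P n → ∃ λ k → P k × (∀ {j} → j < k → ¬ P j)
  least {n} = <-rec (λ n → P n → ∃ λ k → P k × (∀ {j} → j < k → ¬ P j)) step n
    where
    step : ∀ n → (∀ {m} → m < n → P m → ∃ λ k → P k × (∀ {j} → j < k → ¬ P j)) →
           P n → ∃ λ k → P k × (∀ {j} → j < k → ¬ P j)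
    step n smaller Pn with anyUpTo? P? n
    ... | yes (m , m<n , Pm) = smaller m<n Pm
    ... | no  none           = n , Pn , λ j<n Pj → none (_ , j<n , Pj)

  greatest : ∀ B {a} → P a → a ≤ B → ∃ λ t → P t × (∀ {t′} → P t′ → t′ ≤ B → t′ ≤ t)
  greatest B Pa a≤B with P? B
  ... | yes PB = B , PB , λ _ t′≤B → t′≤B
  greatest zero    Pa z≤n | no ¬PB = contradiction Pa ¬PB
  greatest (suc B) Pa a≤B | no ¬PB with m≤n⇒m<n∨m≡n a≤B
  ... | inj₂ refl      = contradiction Pa ¬PB
  ... | inj₁ (s≤s a≤B) =
    let t , Pt , below = greatest B Pa a≤B
    in t , Pt , λ Pt′ t′≤1+B → below Pt′ (m<1+n⇒m≤n (≤∧≢⇒< t′≤1+B λ { refl → ¬PB Pt′ }))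

Searchable : Set → Set₁
Searchable A = ∀ {P : A → Set} → Decidable P → Dec (∃ P)

Vec-searchable : ∀ {A} → Searchable A → ∀ k → Searchable (Vec A k)
Vec-searchable search zero    P? = map′ ([] ,_) (λ { ([] , p) → p }) (P? [])
Vec-searchable search (suc k) P? =
  map′ (λ (x , xs , p) → x ∷ xs , p) (λ { (x ∷ xs , p) → x , xs , p })
       (search λ x → Vec-searchable search k (P? ∘ (x ∷_)))

module _ {A : Set} (q : A → Bool) where

  length-filter-++ : ∀ xs ys →
    length (filter (T? ∘ q) (xs ++ ys)) ≡ length (filter (T? ∘ q) xs) + length (filter (T? ∘ q) ys)
  length-filter-++ xs ys = trans (cong length (filter-++ (T? ∘ q) xs ys)) (length-++ (filter (T? ∘ q) xs))

  length-filter-tabulate : ∀ {n} (f : Fin n → A) →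
    length (filter (T? ∘ q) (tabulate f)) ≡ ∑[ i < n ] indicator (q (f i))
  length-filter-tabulate {zero}  f = refl
  length-filter-tabulate {suc n} f with q (f zero)
  ... | true  = cong suc (length-filter-tabulate (f ∘ suc))
  ... | false = length-filter-tabulate (f ∘ suc)

length-filter-cartesianProduct : ∀ {A B : Set} {m n} (q : A × B → Bool) (f : Fin m → A) (g : Fin n → B) →
  length (filter (T? ∘ q) (cartesianProduct (tabulate f) (tabulate g))) ≡ ∑[ i < m ] ∑[ j < n ] indicator (q (f i , g j))
length-filter-cartesianProduct {m = zero}  q f g = refl
length-filter-cartesianProduct {m = suc m} q f g = begin
  length (filter (T? ∘ q) (map (f zero ,_) (tabulate g) ++ cartesianProduct (tabulate (f ∘ suc)) (tabulate g)))
    ≡⟨ length-filter-++ q (map (f zero ,_) (tabulate g)) _ ⟩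
  length (filter (T? ∘ q) (map (f zero ,_) (tabulate g)))
    + length (filter (T? ∘ q) (cartesianProduct (tabulate (f ∘ suc)) (tabulate g)))
    ≡⟨ cong₂ _+_ (trans (cong (length ∘ filter (T? ∘ q)) (map-tabulate g (f zero ,_)))
                        (length-filter-tabulate q ((f zero ,_) ∘ g)))
                 (length-filter-cartesianProduct q (f ∘ suc) g) ⟩
  ∑[ i < suc m ] ∑[ j < _ ] indicator (q (f i , g j)) ∎
  where open ≡-Reasoning

Any-filter⁺ : ∀ {A : Set} {P Q R : A → Set} (Q? : Decidable Q) {xs} →
  All R xs → (∀ {x} → R x → P x → Q x) → Any P xs → Any P (filter Q? xs)
Any-filter⁺ Q? rs RP⇒Q p =
  [ id , (λ ¬q → contradiction (uncurry RP⇒Q (All.lookupAny rs p)) ¬q) ]′ (Any.filter⁺ Q? p)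

lookup-injective : ∀ {A : Set} {xs : List A} → Unique xs → ∀ {i j} → List.lookup xs i ≡ List.lookup xs j → i ≡ j
lookup-injective (_  ∷ _) {zero}  {zero}  _ = refl
lookup-injective (x≢ ∷ _) {zero}  {suc j} e = contradiction e (All.lookup x≢ (∈-lookup j))
lookup-injective (x≢ ∷ _) {suc i} {zero}  e = contradiction (sym e) (All.lookup x≢ (∈-lookup i))
lookup-injective (_  ∷ u) {suc i} {suc j} e = cong suc (lookup-injective u e)

data PunchInView {n} (v : Fin (suc n)) : Fin (suc n) → Set where
  at-v      : PunchInView v v
  punchedIn : ∀ x → PunchInView v (punchIn v x)

punchInView : ∀ {n} (v x : Fin (suc n)) → PunchInView v x
punchInView v x with v ≟ x
... | yes refl = at-v
... | no  v≢x  = subst (PunchInView v) (punchIn-punchOut v≢x) (punchedIn (punchOut v≢x))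

restrict : ∀ {n} → Fin (suc n) → Subset (suc n) → Subset n
restrict v S = Vec.tabulate (lookup S ∘ punchIn v)

∈-restrict⁺ : ∀ {n} {v : Fin (suc n)} {S x} → punchIn v x ∈ S → x ∈ restrict v S
∈-restrict⁺ {v = v} {S} {x} x∈S =
  lookup⇒[]= x _ (trans (lookup∘tabulate (lookup S ∘ punchIn v) x) ([]=⇒lookup x∈S))

∈-restrict⁻ : ∀ {n} {v : Fin (suc n)} {S x} → x ∈ restrict v S → punchIn v x ∈ S
∈-restrict⁻ {v = v} {S} {x} x∈S =
  lookup⇒[]= _ S (trans (sym (lookup∘tabulate (lookup S ∘ punchIn v) x)) ([]=⇒lookup x∈S))

extend : ∀ {n} → Fin (suc n) → Subset n → Subset (suc n)
extend v S = insertAt S v outside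

v∉extend : ∀ {n} (v : Fin (suc n)) (S : Subset n) → v ∉ extend v S
v∉extend v S v∈S with trans (sym (insertAt-lookup S v outside)) ([]=⇒lookup v∈S)
... | ()

∈-extend⁺ : ∀ {n} {v : Fin (suc n)} {S x} → x ∈ S → punchIn v x ∈ extend v S
∈-extend⁺ {v = v} {S} {x} x∈S = lookup⇒[]= _ _ (trans (insertAt-punchIn S v outside x) ([]=⇒lookup x∈S))

∈-extend⁻ : ∀ {n} {v : Fin (suc n)} {S x} → punchIn v x ∈ extend v S → x ∈ S
∈-extend⁻ {v = v} {S} {x} x∈S = lookup⇒[]= x S (trans (sym (insertAt-punchIn S v outside x)) ([]=⇒lookup x∈S))

isEdge : ∀ {n} → Graph n → Fin n → Fin n → Bool
isEdge G i j = (toℕ i <ᵇ toℕ j) ∧ adj G i j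

isEdge-nonadjacent : ∀ {n} (G : Graph n) {i j} → adj G i j ≡ false → isEdge G i j ≡ false
isEdge-nonadjacent G {i} {j} i≁j = trans (cong ((toℕ i <ᵇ toℕ j) ∧_) i≁j) (Bool.∧-zeroʳ _)

edgeCount≡∑∑ : ∀ {n} (G : Graph n) → edgeCount G ≡ ∑[ i < n ] ∑[ j < n ] indicator (isEdge G i j)
edgeCount≡∑∑ G = length-filter-cartesianProduct (λ p → isEdge G (proj₁ p) (proj₂ p)) id id

_≈ᴳ_ : ∀ {n} → Graph n → Graph n → Set
G ≈ᴳ H = ∀ i j → adj G i j ≡ adj H i j

edgeCount-cong : ∀ {n} {G H : Graph n} → G ≈ᴳ H → edgeCount G ≡ edgeCount H
edgeCount-cong {G = G} {H} G≈H = begin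
  edgeCount G                                     ≡⟨ edgeCount≡∑∑ G ⟩
  ∑[ i < _ ] ∑[ j < _ ] indicator (isEdge G i j)  ≡⟨ sum-cong-≗ (λ i → sum-cong-≗ λ j →
                                                       cong (indicator ∘ ((toℕ i <ᵇ toℕ j) ∧_)) (G≈H i j)) ⟩
  ∑[ i < _ ] ∑[ j < _ ] indicator (isEdge H i j)  ≡⟨ edgeCount≡∑∑ H ⟨
  edgeCount H                                     ∎
  where open ≡-Reasoning

Isolated : ∀ {n} → Graph n → Fin n → Set
Isolated G v = ∀ w → adj G v w ≡ false

isolated-adjʳ : ∀ {n} (G : Graph n) {v} → Isolated G v → ∀ w → adj G w v ≡ false
isolated-adjʳ G {v} v-isolated w = trans (Graph.sym G w v) (v-isolated w)

removeVertex : ∀ {n} → Graph (suc n) → Fin (suc n) → Graph n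
removeVertex G v = record
  { adj    = λ i j → adj G (punchIn v i) (punchIn v j)
  ; sym    = λ i j → Graph.sym G (punchIn v i) (punchIn v j)
  ; irrefl = λ i → irrefl G (punchIn v i)
  }

addIsolated : ∀ {n} → Graph n → Graph (suc n)
addIsolated {n} G = record { adj = adj′ ; sym = sym′ ; irrefl = irrefl′ }
  where
  adj′ : Fin (suc n) → Fin (suc n) → Bool
  adj′ (suc i) (suc j) = adj G i j
  adj′ _       _       = false
  sym′ : ∀ i j → adj′ i j ≡ adj′ j i
  sym′ zero    zero    = refl
  sym′ zero    (suc j) = refl
  sym′ (suc i) zero    = refl
  sym′ (suc i) (suc j) = Graph.sym G i j
  irrefl′ : ∀ i → adj′ i i ≡ false
  irrefl′ zero    = refl
  irrefl′ (suc i) = irrefl G i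

addIsolated-isolated : ∀ {n} (G : Graph n) → Isolated (addIsolated G) zero
addIsolated-isolated G _ = refl

punchIn-<ᵇ : ∀ {n} (v : Fin (suc n)) i j → (toℕ (punchIn v i) <ᵇ toℕ (punchIn v j)) ≡ (toℕ i <ᵇ toℕ j)
punchIn-<ᵇ zero    i       j       = refl
punchIn-<ᵇ (suc v) zero    zero    = refl
punchIn-<ᵇ (suc v) zero    (suc j) = refl
punchIn-<ᵇ (suc v) (suc i) zero    = refl
punchIn-<ᵇ (suc v) (suc i) (suc j) = punchIn-<ᵇ v i j

edgeCount-removeVertex : ∀ {n} (G : Graph (suc n)) v → Isolated G v → edgeCount (removeVertex G v) ≡ edgeCount G
edgeCount-removeVertex {n} G v v-isolated = sym (begin
  edgeCount G
    ≡⟨ edgeCount≡∑∑ G ⟩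
  ∑[ i < suc n ] ∑[ j < suc n ] e i j
    ≡⟨ sum-remove {i = v} (λ i → ∑[ j < suc n ] e i j) ⟩
  ∑[ j < suc n ] e v j + ∑[ i < n ] ∑[ j < suc n ] e (punchIn v i) j
    ≡⟨ cong₂ _+_ (sum-zero λ j → cong indicator (isEdge-nonadjacent G (v-isolated j)))
                 (sum-cong-≗ λ i → sum-remove {i = v} (e (punchIn v i))) ⟩
  ∑[ i < n ] (e (punchIn v i) v + ∑[ j < n ] e (punchIn v i) (punchIn v j))
    ≡⟨ sum-cong-≗ (λ i → cong₂ _+_
         (cong indicator (isEdge-nonadjacent G (isolated-adjʳ G v-isolated (punchIn v i))))
         (sum-cong-≗ λ j → cong (indicator ∘ (_∧ adj G (punchIn v i) (punchIn v j))) (punchIn-<ᵇ v i j))) ⟩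
  ∑[ i < n ] ∑[ j < n ] indicator (isEdge (removeVertex G v) i j)
    ≡⟨ edgeCount≡∑∑ (removeVertex G v) ⟨
  edgeCount (removeVertex G v) ∎)
  where
  open ≡-Reasoning
  e : Fin (suc n) → Fin (suc n) → ℕ
  e i j = indicator (isEdge G i j)

-- Clique covers

⁅⁆-clique : ∀ {n} (G : Graph n) x → IsClique G ⁅ x ⁆
⁅⁆-clique G x i j i∈ j∈ i≢j = contradiction (trans (x∈⁅y⁆⇒x≡y x i∈) (sym (x∈⁅y⁆⇒x≡y x j∈))) i≢j

IsTheta-unique : ∀ {n} (G : Graph n) {k l} → IsTheta G k → IsTheta G l → k ≡ l
IsTheta-unique G ((C , C-cover , refl) , k-minimal) ((D , D-cover , refl) , l-minimal) =
  ≤-antisym (k-minimal D D-cover) (l-minimal C C-cover)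

IsCliqueCover-cong : ∀ {n} {G H : Graph n} → G ≈ᴳ H → ∀ {C} → IsCliqueCover G C → IsCliqueCover H C
IsCliqueCover-cong G≈H (cliques , covers-vertices , covers-edges) =
  All.map (λ {S} S-clique i j i∈ j∈ i≢j → trans (sym (G≈H i j)) (S-clique i j i∈ j∈ i≢j)) cliques ,
  covers-vertices ,
  λ i j i~j → covers-edges i j (trans (G≈H i j) i~j)

IsTheta-cong : ∀ {n} {G H : Graph n} → G ≈ᴳ H → ∀ {k} → IsTheta G k → IsTheta H k
IsTheta-cong {G = G} {H} G≈H ((C , C-cover , |C|≡k) , minimal) =
  (C , IsCliqueCover-cong {G = G} {H} G≈H C-cover , |C|≡k) ,
  λ D D-cover → minimal D (IsCliqueCover-cong {G = H} {G} (λ i j → sym (G≈H i j)) D-cover)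

module IsolatedVertex {n} (G : Graph (suc n)) (v : Fin (suc n)) (v-isolated : Isolated G v) where

  private
    G′ : Graph n
    G′ = removeVertex G v

  extend-clique : ∀ {S} → IsClique G′ S → IsClique G (extend v S)
  extend-clique {S} S-clique i j i∈ j∈ i≢j with punchInView v i | punchInView v j
  ... | at-v         | _            = contradiction i∈ (v∉extend v S)
  ... | punchedIn _  | at-v         = contradiction j∈ (v∉extend v S)
  ... | punchedIn i′ | punchedIn j′ = S-clique i′ j′ (∈-extend⁻ i∈) (∈-extend⁻ j∈) (i≢j ∘ cong (punchIn v))

  extend-cover : ∀ {C} → IsCliqueCover G′ C → IsCliqueCover G (⁅ v ⁆ ∷ map (extend v) C)
  extend-cover {C} (cliques , covers-vertices , covers-edges) =
    ⁅⁆-clique G v ∷ All.map⁺ (All.map extend-clique cliques) , vertex , edge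
    where
    vertex : ∀ w → Any (w ∈_) (⁅ v ⁆ ∷ map (extend v) C)
    vertex w with punchInView v w
    ... | at-v         = here (x∈⁅x⁆ v)
    ... | punchedIn w′ = there (Any.map⁺ (Any.map ∈-extend⁺ (covers-vertices w′)))
    edge : ∀ i j → adj G i j ≡ true → Any (λ S → i ∈ S × j ∈ S) (⁅ v ⁆ ∷ map (extend v) C)
    edge i j i~j with punchInView v i | punchInView v j
    ... | at-v         | _            = contradiction (trans (sym i~j) (v-isolated j)) λ ()
    ... | punchedIn _  | at-v         = contradiction (trans (sym i~j) (isolated-adjʳ G v-isolated i)) λ ()
    ... | punchedIn i′ | punchedIn j′ =
      there (Any.map⁺ (Any.map (Product.map ∈-extend⁺ ∈-extend⁺) (covers-edges i′ j′ i~j)))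

  v∉clique : ∀ {S x} → IsClique G S → x ∈ S → x ≢ v → v ∉ S
  v∉clique S-clique x∈ x≢v v∈ =
    contradiction (trans (sym (S-clique v _ v∈ x∈ (x≢v ∘ sym))) (v-isolated _)) λ ()

  restrict-clique : ∀ {S} → IsClique G S → IsClique G′ (restrict v S)
  restrict-clique S-clique i j i∈ j∈ i≢j =
    S-clique _ _ (∈-restrict⁻ i∈) (∈-restrict⁻ j∈) (i≢j ∘ punchIn-injective v i j)

  v∉? : Decidable (v ∉_)
  v∉? S = ¬? (v ∈? S)

  restrictCover : List (Subset (suc n)) → List (Subset n)
  restrictCover C = map (restrict v) (filter v∉? C)

  restrict-cover : ∀ {C} → IsCliqueCover G C → IsCliqueCover G′ (restrictCover C)
  restrict-cover {C} (cliques , covers-vertices , covers-edges) =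
    All.map⁺ (All.map restrict-clique (All.filter⁺ v∉? cliques)) , vertex , edge
    where
    vertex : ∀ w → Any (w ∈_) (restrictCover C)
    vertex w = Any.map⁺ (Any.map ∈-restrict⁺
      (Any-filter⁺ v∉? cliques (λ S-clique w∈ → v∉clique S-clique w∈ (punchInᵢ≢i v w))
        (covers-vertices (punchIn v w))))
    edge : ∀ i j → adj G′ i j ≡ true → Any (λ S → i ∈ S × j ∈ S) (restrictCover C)
    edge i j i~j = Any.map⁺ (Any.map (Product.map ∈-restrict⁺ ∈-restrict⁺)
      (Any-filter⁺ v∉? cliques (λ S-clique ij∈ → v∉clique S-clique (proj₁ ij∈) (punchInᵢ≢i v i))
        (covers-edges _ _ i~j)))

  restrictCover-shorter : ∀ {C} → IsCliqueCover G C → length (restrictCover C) < length C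
  restrictCover-shorter {C} (_ , covers-vertices , _) =
    subst (_< length C) (sym (length-map (restrict v) (filter v∉? C)))
          (filter-notAll v∉? C (Any.map (λ v∈ v∉ → v∉ v∈) (covers-vertices v)))

  IsTheta-isolated : ∀ {k} → IsTheta G′ k → IsTheta G (suc k)
  IsTheta-isolated ((C , C-cover , refl) , minimal) =
    (⁅ v ⁆ ∷ map (extend v) C , extend-cover C-cover , cong suc (length-map (extend v) C)) ,
    λ D D-cover → ≤-trans (s≤s (minimal _ (restrict-cover D-cover))) (restrictCover-shorter D-cover)

TriangleFree : ∀ {n} → Graph n → Set
TriangleFree G = ∀ x y z → adj G x y ≡ true → adj G y z ≡ true → adj G x z ≡ true → ⊥

module Edges {n} (G : Graph n) where

  isEdge? : Decidable (λ (p : Fin n × Fin n) → T (isEdge G (proj₁ p) (proj₂ p)))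
  isEdge? p = T? (isEdge G (proj₁ p) (proj₂ p))

  edges : List (Fin n × Fin n)
  edges = filter isEdge? (cartesianProduct (allFin n) (allFin n))

  ∈-edges⁺ : ∀ {i j} → toℕ i < toℕ j → adj G i j ≡ true → (i , j) ∈ₗ edges
  ∈-edges⁺ {i} {j} i<j i~j = ∈-filter⁺ isEdge? (∈-cartesianProduct⁺ (∈-allFin i) (∈-allFin j))
    (Equivalence.from Bool.T-∧ (<⇒<ᵇ i<j , Equivalence.from Bool.T-≡ i~j))

  ∈-edges⁻ : ∀ {i j} → (i , j) ∈ₗ edges → toℕ i < toℕ j × adj G i j ≡ true
  ∈-edges⁻ ij∈ = Product.map (<ᵇ⇒< _ _) (Equivalence.to Bool.T-≡)
    (Equivalence.to Bool.T-∧ (proj₂ (∈-filter⁻ isEdge? {xs = cartesianProduct (allFin n) (allFin n)} ij∈)))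

  edges-unique : Unique edges
  edges-unique = Unique.filter⁺ isEdge? (Unique.cartesianProduct⁺ (Unique.allFin⁺ n) (Unique.allFin⁺ n))

  edgeSet : Fin n × Fin n → Subset n
  edgeSet (i , j) = ⁅ i ⁆ ∪ ⁅ j ⁆

  ∈-edgeSet : ∀ i j → i ∈ edgeSet (i , j) × j ∈ edgeSet (i , j)
  ∈-edgeSet i j = x∈p∪q⁺ (inj₁ (x∈⁅x⁆ i)) , x∈p∪q⁺ (inj₂ (x∈⁅x⁆ j))

  edgeSet-clique : ∀ {i j} → adj G i j ≡ true → IsClique G (edgeSet (i , j))
  edgeSet-clique {i} {j} i~j x y x∈ y∈ x≢y with x∈p∪q⁻ ⁅ i ⁆ ⁅ j ⁆ x∈ | x∈p∪q⁻ ⁅ i ⁆ ⁅ j ⁆ y∈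
  ... | inj₁ x∈ᵢ | inj₁ y∈ᵢ = contradiction (trans (x∈⁅y⁆⇒x≡y i x∈ᵢ) (sym (x∈⁅y⁆⇒x≡y i y∈ᵢ))) x≢y
  ... | inj₂ x∈ⱼ | inj₂ y∈ⱼ = contradiction (trans (x∈⁅y⁆⇒x≡y j x∈ⱼ) (sym (x∈⁅y⁆⇒x≡y j y∈ⱼ))) x≢y
  ... | inj₁ x∈ᵢ | inj₂ y∈ⱼ rewrite x∈⁅y⁆⇒x≡y i x∈ᵢ | x∈⁅y⁆⇒x≡y j y∈ⱼ = i~j
  ... | inj₂ x∈ⱼ | inj₁ y∈ᵢ rewrite x∈⁅y⁆⇒x≡y j x∈ⱼ | x∈⁅y⁆⇒x≡y i y∈ᵢ = trans (Graph.sym G j i) i~j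

  edgeCover : List (Subset n)
  edgeCover = map edgeSet edges

  length-edgeCover : length edgeCover ≡ edgeCount G
  length-edgeCover = length-map edgeSet edges

  edgeCover-cliques : All (IsClique G) edgeCover
  edgeCover-cliques = All.map⁺ (All.tabulate λ p∈ → edgeSet-clique (proj₂ (∈-edges⁻ p∈)))

  edgeCover-edges : ∀ i j → adj G i j ≡ true → Any (λ S → i ∈ S × j ∈ S) edgeCover
  edgeCover-edges i j i~j with <-cmp (toℕ i) (toℕ j)
  ... | tri< i<j _ _ = Any.map⁺ (Any.map (λ { refl → ∈-edgeSet i j }) (∈-edges⁺ i<j i~j))
  ... | tri> _ _ j<i = Any.map⁺ (Any.map (λ { refl → swap (∈-edgeSet j i) })
                                         (∈-edges⁺ j<i (trans (Graph.sym G j i) i~j)))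
  ... | tri≈ _ i≡j _ = contradiction
    (trans (sym i~j) (subst (λ k → adj G i k ≡ false) (toℕ-injective i≡j) (irrefl G i))) λ ()

  edgeCover-cover : (∀ v → ¬ Isolated G v) → IsCliqueCover G edgeCover
  edgeCover-cover no-isolated = edgeCover-cliques , vertex , edgeCover-edges
    where
    vertex : ∀ v → Any (v ∈_) edgeCover
    vertex v with ¬∀⟶∃¬ n (λ w → adj G v w ≡ false) (λ w → adj G v w Bool.≟ false) (no-isolated v)
    ... | w , v≁w = Any.map proj₁ (edgeCover-edges v w (Bool.¬-not v≁w))

  trivialCover : List (Subset n)
  trivialCover = edgeCover ++ map ⁅_⁆ (allFin n)

  length-trivialCover : length trivialCover ≡ edgeCount G + n
  length-trivialCover = trans (length-++ edgeCover)
    (cong₂ _+_ length-edgeCover (trans (length-map ⁅_⁆ (allFin n)) (length-tabulate id)))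

  trivialCover-cover : IsCliqueCover G trivialCover
  trivialCover-cover =
    All.++⁺ edgeCover-cliques (All.map⁺ (All.tabulate λ {x} _ → ⁅⁆-clique G x)) ,
    (λ v → Any.++⁺ʳ edgeCover (Any.map⁺ (Any.map (λ { refl → x∈⁅x⁆ v }) (∈-allFin v)))) ,
    (λ i j i~j → Any.++⁺ˡ (edgeCover-edges i j i~j))

  module _ (triangle-free : TriangleFree G) where

    clique-third-vertex : ∀ {S x y z} → IsClique G S → x ∈ S → y ∈ S → z ∈ S → x ≢ y → z ≡ x ⊎ z ≡ y
    clique-third-vertex {x = x} {y} {z} S-clique x∈ y∈ z∈ x≢y with z ≟ x | z ≟ y
    ... | yes z≡x | _       = inj₁ z≡x
    ... | no _    | yes z≡y = inj₂ z≡y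
    ... | no z≢x  | no z≢y  = ⊥-elim (triangle-free x y z
      (S-clique x y x∈ y∈ x≢y) (S-clique y z y∈ z∈ (z≢y ∘ sym)) (S-clique x z x∈ z∈ (z≢x ∘ sym)))

    clique-edge-unique : ∀ {S x y x′ y′} → IsClique G S → (x , y) ∈ₗ edges → (x′ , y′) ∈ₗ edges →
                         x ∈ S × y ∈ S → x′ ∈ S × y′ ∈ S → (x , y) ≡ (x′ , y′)
    clique-edge-unique S-clique xy∈ x′y′∈ (x∈ , y∈) (x′∈ , y′∈)
      with ∈-edges⁻ xy∈ | ∈-edges⁻ x′y′∈
    ... | x<y , _ | x′<y′ , _
      with clique-third-vertex S-clique x∈ y∈ x′∈ (<⇒≢ x<y) | clique-third-vertex S-clique x∈ y∈ y′∈ (<⇒≢ x<y)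
    ... | inj₁ refl | inj₁ refl = ⊥-elim (<-irrefl refl x′<y′)
    ... | inj₁ refl | inj₂ refl = refl
    ... | inj₂ refl | inj₁ refl = ⊥-elim (<-asym x<y x′<y′)
    ... | inj₂ refl | inj₂ refl = ⊥-elim (<-irrefl refl x′<y′)

    edgeCount≤cover : ∀ {C} → IsCliqueCover G C → edgeCount G ≤ length C
    edgeCount≤cover {C} (cliques , _ , covers-edges) = injective⇒≤ coveringClique-injective
      where
      covering : ∀ e → Any (λ S → proj₁ (List.lookup edges e) ∈ S × proj₂ (List.lookup edges e) ∈ S) C
      covering e = covers-edges _ _ (proj₂ (∈-edges⁻ (∈-lookup e)))
      coveringClique-injective : ∀ {e e′} → Any.index (covering e) ≡ Any.index (covering e′) → e ≡ e′
      coveringClique-injective {e} {e′} same = lookup-injective edges-unique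
        (clique-edge-unique (All.lookup cliques (∈-lookup (Any.index (covering e))))
          (∈-lookup e) (∈-lookup e′) (Any.lookup-index (covering e))
          (subst (λ k → _ ∈ List.lookup C k × _ ∈ List.lookup C k) (sym same) (Any.lookup-index (covering e′))))

    edgeCount≤θ : ∀ {k} → IsTheta G k → edgeCount G ≤ k
    edgeCount≤θ ((_ , C-cover , refl) , _) = edgeCount≤cover C-cover

-- Existence of θ and Θ

clique? : ∀ {n} (G : Graph n) → Decidable (IsClique G)
clique? G S = all? λ i → all? λ j →
  (i ∈? S) →-dec (j ∈? S) →-dec ¬? (i ≟ j) →-dec (adj G i j Bool.≟ true)

cliqueCover? : ∀ {n} (G : Graph n) → Decidable (IsCliqueCover G)
cliqueCover? G C =
  All.all? (clique? G) C ×-dec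
  all? (λ v → Any.any? (v ∈?_) C) ×-dec
  all? (λ i → all? λ j → (adj G i j Bool.≟ true) →-dec Any.any? (λ S → (i ∈? S) ×-dec (j ∈? S)) C)

HasCoverOfSize : ∀ {n} → Graph n → ℕ → Set
HasCoverOfSize G k = ∃ λ C → IsCliqueCover G C × length C ≡ k

hasCoverOfSize? : ∀ {n} (G : Graph n) → Decidable (HasCoverOfSize G)
hasCoverOfSize? G k =
  map′ (λ (C , C-cover) → Vec.toList C , C-cover , length-toList C)
       (λ { (C , C-cover , refl) → Vec.fromList C , subst (IsCliqueCover G) (sym (toList∘fromList C)) C-cover })
       (Vec-searchable anySubset? k (cliqueCover? G ∘ Vec.toList))

θ-exists : ∀ {n} (G : Graph n) → ∃ λ k → IsTheta G k × k ≤ edgeCount G + n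
θ-exists G =
  let k , k-cover , below = least (hasCoverOfSize? G) (trivialCover , trivialCover-cover , length-trivialCover)
      minimal : ∀ C → IsCliqueCover G C → k ≤ length C
      minimal C C-cover = ≮⇒≥ λ |C|<k → below |C|<k (C , C-cover , refl)
  in k , (k-cover , minimal) , subst (k ≤_) length-trivialCover (minimal trivialCover trivialCover-cover)
  where open Edges G

θ : ∀ {n} → Graph n → ℕ
θ G = proj₁ (θ-exists G)

θ-IsTheta : ∀ {n} (G : Graph n) → IsTheta G (θ G)
θ-IsTheta G = proj₁ (proj₂ (θ-exists G))

θ≤edgeCount+n : ∀ {n} (G : Graph n) → θ G ≤ edgeCount G + n
θ≤edgeCount+n G = proj₂ (proj₂ (θ-exists G))

-- A code is an n × n Boolean matrix; only its entries above the diagonal are read.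
Code : ℕ → Set
Code n = Vec (Subset n) n

fromCode : ∀ {n} → Code n → Graph n
fromCode {n} c = record
  { adj    = λ i j → ((toℕ i <ᵇ toℕ j) ∧ c[ i , j ]) ∨ ((toℕ j <ᵇ toℕ i) ∧ c[ j , i ])
  ; sym    = λ i j → Bool.∨-comm ((toℕ i <ᵇ toℕ j) ∧ c[ i , j ]) _
  ; irrefl = λ i → cong (λ b → (b ∧ c[ i , i ]) ∨ (b ∧ c[ i , i ])) (≥⇒<ᵇ≡false (≤-refl {toℕ i}))
  }
  where
  c[_,_] : Fin n → Fin n → Bool
  c[ i , j ] = lookup (lookup c i) j

toCode : ∀ {n} → Graph n → Code n
toCode G = Vec.tabulate λ i → Vec.tabulate λ j → adj G i j

fromCode-toCode : ∀ {n} (G : Graph n) → fromCode (toCode G) ≈ᴳ G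
fromCode-toCode G i j
  rewrite lookup∘tabulate (λ i → Vec.tabulate (adj G i)) i | lookup∘tabulate (adj G i) j
        | lookup∘tabulate (λ i → Vec.tabulate (adj G i)) j | lookup∘tabulate (adj G j) i
  with <-cmp (toℕ i) (toℕ j)
... | tri< i<j _ _ rewrite <⇒<ᵇ≡true i<j | ≥⇒<ᵇ≡false (<⇒≤ i<j) = Bool.∨-identityʳ (adj G i j)
... | tri> _ _ j<i rewrite <⇒<ᵇ≡true j<i | ≥⇒<ᵇ≡false (<⇒≤ j<i) = Graph.sym G j i
... | tri≈ _ i≡j _ rewrite toℕ-injective i≡j | ≥⇒<ᵇ≡false (≤-refl {toℕ j}) = sym (irrefl G j)

Θ-exists : ∀ {n} m → (∃ λ (G : Graph n) → edgeCount G ≡ m) → ∃ (IsBigTheta n m)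
Θ-exists {n} m (G₀ , G₀-edges) =
  let G₀-attains = attains G₀ G₀-edges (θ-IsTheta G₀)
      t , (c , c-edges , θc≡t) , below = greatest Attained? (m + n) G₀-attains (Attained-bounded G₀-attains)
  in t , (fromCode c , c-edges , subst (IsTheta (fromCode c)) θc≡t (θ-IsTheta (fromCode c))) ,
     λ G G-edges k θG≡k → let G-attains = attains G G-edges θG≡k in below G-attains (Attained-bounded G-attains)
  where
  Attained : ℕ → Set
  Attained t = ∃ λ (c : Code n) → edgeCount (fromCode c) ≡ m × θ (fromCode c) ≡ t

  Attained? : Decidable Attained
  Attained? t = Vec-searchable anySubset? n λ c → (edgeCount (fromCode c) ℕ.≟ m) ×-dec (θ (fromCode c) ℕ.≟ t)

  attains : ∀ G {k} → edgeCount G ≡ m → IsTheta G k → Attained k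
  attains G G-edges θG≡k =
    toCode G ,
    trans (edgeCount-cong {G = G′} {G} (fromCode-toCode G)) G-edges ,
    IsTheta-unique G′ (θ-IsTheta G′) (IsTheta-cong {G = G} {G′} (λ i j → sym (fromCode-toCode G i j)) θG≡k)
    where
    G′ : Graph n
    G′ = fromCode (toCode G)

  Attained-bounded : ∀ {t} → Attained t → t ≤ m + n
  Attained-bounded (c , c-edges , refl) = subst (λ e → θ (fromCode c) ≤ e + n) c-edges (θ≤edgeCount+n (fromCode c))

-- From Θ_n(m) to Θ_{n+1}(m)

IsBigTheta-suc : ∀ {n m t} → IsBigTheta n m t → m ≤ t → IsBigTheta (suc n) m (suc t)
IsBigTheta-suc {n} {m} {t} ((G , G-edges , θG≡t) , θ≤t) m≤t =
  -- removeVertex (addIsolated G) zero reduces to G.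
  (addIsolated G ,
   trans (sym (edgeCount-removeVertex (addIsolated G) zero (addIsolated-isolated G))) G-edges ,
   IsolatedVertex.IsTheta-isolated (addIsolated G) zero (addIsolated-isolated G) θG≡t) ,
  θ≤1+t
  where
  θ≤1+t : ∀ (H : Graph (suc n)) → edgeCount H ≡ m → ∀ k → IsTheta H k → k ≤ suc t
  θ≤1+t H H-edges k θH≡k with any? (λ v → all? λ w → adj H v w Bool.≟ false)
  ... | yes (v , v-isolated) =
    let H-v = removeVertex H v
    in subst (_≤ suc t) (IsTheta-unique H (IsolatedVertex.IsTheta-isolated H v v-isolated (θ-IsTheta H-v)) θH≡k)
             (s≤s (θ≤t H-v (trans (edgeCount-removeVertex H v v-isolated) H-edges) (θ H-v) (θ-IsTheta H-v)))
  ... | no no-isolated = begin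
    k                 ≤⟨ proj₂ θH≡k edgeCover (edgeCover-cover λ v v-isolated → no-isolated (v , v-isolated)) ⟩
    length edgeCover  ≡⟨ trans length-edgeCover H-edges ⟩
    m                 ≤⟨ m≤t ⟩
    t                 ≤⟨ n≤1+n t ⟩
    suc t             ∎
    where
    open Edges H
    open ≤-Reasoning

IsBigTheta-suc-triangleFree : ∀ {n} (G : Graph n) → TriangleFree G →
  ∃ λ t → IsBigTheta n (edgeCount G) t × IsBigTheta (suc n) (edgeCount G) (suc t)
IsBigTheta-suc-triangleFree G G-triangleFree =
  let t , Θ@(_ , θ≤t) = Θ-exists (edgeCount G) (G , refl)
      m≤t = ≤-trans (Edges.edgeCount≤θ G G-triangleFree (θ-IsTheta G)) (θ≤t G refl (θ G) (θ-IsTheta G))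
  in t , Θ , IsBigTheta-suc Θ m≤t

-- Triangle-free graphs with many edges

module Bipartite {a b} (R : Fin a → Fin b → Bool) where

  crossing : Fin a ⊎ Fin b → Fin a ⊎ Fin b → Bool
  crossing (inj₁ i) (inj₂ j) = R i j
  crossing (inj₂ j) (inj₁ i) = R i j
  crossing _        _        = false

  bipartite : Graph (a + b)
  bipartite = record
    { adj    = λ x y → crossing (splitAt a x) (splitAt a y)
    ; sym    = λ x y → crossing-sym (splitAt a x) (splitAt a y)
    ; irrefl = λ x → crossing-irrefl (splitAt a x)
    }
    where
    crossing-sym : ∀ p q → crossing p q ≡ crossing q p
    crossing-sym (inj₁ _) (inj₁ _) = refl
    crossing-sym (inj₁ _) (inj₂ _) = refl
    crossing-sym (inj₂ _) (inj₁ _) = refl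
    crossing-sym (inj₂ _) (inj₂ _) = refl
    crossing-irrefl : ∀ p → crossing p p ≡ false
    crossing-irrefl (inj₁ _) = refl
    crossing-irrefl (inj₂ _) = refl

  bipartite-triangleFree : TriangleFree bipartite
  bipartite-triangleFree x y z = crossing-triangleFree (splitAt a x) (splitAt a y) (splitAt a z)
    where
    crossing-triangleFree : ∀ p q r → crossing p q ≡ true → crossing q r ≡ true → crossing p r ≡ true → ⊥
    crossing-triangleFree (inj₁ _) (inj₁ _) _        () _  _
    crossing-triangleFree (inj₂ _) (inj₂ _) _        () _  _
    crossing-triangleFree (inj₁ _) (inj₂ _) (inj₁ _) _  _  ()
    crossing-triangleFree (inj₁ _) (inj₂ _) (inj₂ _) _  () _
    crossing-triangleFree (inj₂ _) (inj₁ _) (inj₁ _) _  () _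
    crossing-triangleFree (inj₂ _) (inj₁ _) (inj₂ _) _  _  ()

  private
    e : Fin (a + b) → Fin (a + b) → ℕ
    e x y = indicator (isEdge bipartite x y)

    left<right : ∀ (i : Fin a) (j : Fin b) → toℕ (i ↑ˡ b) < toℕ (a ↑ʳ j)
    left<right i j = subst₂ _<_ (sym (toℕ-↑ˡ i b)) (sym (toℕ-↑ʳ a j)) (≤-trans (toℕ<n i) (m≤m+n a (toℕ j)))

    row-left : ∀ i → ∑[ y < a + b ] e (i ↑ˡ b) y ≡ ∑[ j < b ] indicator (R i j)
    row-left i = begin
      ∑[ y < a + b ] e (i ↑ˡ b) y
        ≡⟨ sum-↑ a (e (i ↑ˡ b)) ⟩
      ∑[ i′ < a ] e (i ↑ˡ b) (i′ ↑ˡ b) + ∑[ j < b ] e (i ↑ˡ b) (a ↑ʳ j)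
        ≡⟨ cong₂ _+_ (sum-zero λ i′ → cong indicator (isEdge-nonadjacent bipartite
                         (cong₂ crossing (splitAt-↑ˡ a i b) (splitAt-↑ˡ a i′ b))))
                     (sum-cong-≗ λ j → cong indicator (cong₂ _∧_ (<⇒<ᵇ≡true (left<right i j))
                         (cong₂ crossing (splitAt-↑ˡ a i b) (splitAt-↑ʳ a b j)))) ⟩
      ∑[ j < b ] indicator (R i j) ∎
      where open ≡-Reasoning

    row-right : ∀ j → ∑[ y < a + b ] e (a ↑ʳ j) y ≡ 0
    row-right j = begin
      ∑[ y < a + b ] e (a ↑ʳ j) y
        ≡⟨ sum-↑ a (e (a ↑ʳ j)) ⟩
      ∑[ i < a ] e (a ↑ʳ j) (i ↑ˡ b) + ∑[ j′ < b ] e (a ↑ʳ j) (a ↑ʳ j′)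
        ≡⟨ cong₂ _+_ (sum-zero λ i → cong (indicator ∘ (_∧ crossing (splitAt a (a ↑ʳ j)) (splitAt a (i ↑ˡ b))))
                                          (≥⇒<ᵇ≡false (<⇒≤ (left<right i j))))
                     (sum-zero λ j′ → cong indicator (isEdge-nonadjacent bipartite
                         (cong₂ crossing (splitAt-↑ʳ a b j) (splitAt-↑ʳ a b j′)))) ⟩
      0 ∎
      where open ≡-Reasoning

  edgeCount-bipartite : edgeCount bipartite ≡ ∑[ i < a ] ∑[ j < b ] indicator (R i j)
  edgeCount-bipartite = begin
    edgeCount bipartite                                                    ≡⟨ edgeCount≡∑∑ bipartite ⟩
    ∑[ x < a + b ] ∑[ y < a + b ] e x y                                    ≡⟨ sum-↑ a _ ⟩
    ∑[ i < a ] ∑[ y < a + b ] e (i ↑ˡ b) y + ∑[ j < b ] ∑[ y < a + b ] e (a ↑ʳ j) y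
                                                                           ≡⟨ cong₂ _+_ (sum-cong-≗ row-left) (sum-zero row-right) ⟩
    ∑[ i < a ] ∑[ j < b ] indicator (R i j) + 0                            ≡⟨ +-identityʳ _ ⟩
    ∑[ i < a ] ∑[ j < b ] indicator (R i j)                                ∎
    where open ≡-Reasoning

-- Joins the first m pairs (i, j) in the lexicographic order of Fin a × Fin b.
prefixRelation : ∀ a b → ℕ → Fin a → Fin b → Bool
prefixRelation a b m i j = toℕ (combine i j) <ᵇ m

edgeCount-prefix : ∀ a b {m} → m ≤ a * b → edgeCount (Bipartite.bipartite (prefixRelation a b m)) ≡ m
edgeCount-prefix a b {m} m≤ab = begin
  edgeCount (Bipartite.bipartite (prefixRelation a b m)) ≡⟨ Bipartite.edgeCount-bipartite (prefixRelation a b m) ⟩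
  ∑[ i < a ] ∑[ j < b ] indicator (toℕ (combine i j) <ᵇ m) ≡⟨ sum-combine a b (λ k → indicator (toℕ k <ᵇ m)) ⟩
  ∑[ k < a * b ] indicator (toℕ k <ᵇ m)                    ≡⟨ sum-indicator-< m m≤ab ⟩
  m                                                        ∎
  where open ≡-Reasoning

lemma8 : ∀ (n : ℕ) → 4 ≤ n → ∀ (m : ℕ) → m ≤ (n * n) / 4 →
    ∃ λ (t : ℕ) → IsBigTheta n m t × IsBigTheta (suc n) m (suc t)
lemma8 n _ m m≤n²/4 with ≤quarterSquare⇒≤product n m≤n²/4
... | a , b , refl , m≤ab =
  subst (λ e → ∃ λ t → IsBigTheta (a + b) e t × IsBigTheta (suc (a + b)) e (suc t))
        (edgeCount-prefix a b m≤ab)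
        (IsBigTheta-suc-triangleFree (Bipartite.bipartite R) (Bipartite.bipartite-triangleFree R))
  where
  R : Fin a → Fin b → Bool
  R = prefixRelation a b m
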